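{- Fix $n \in \mathbb{N}$ and let $p_1 < p_2 < \cdots < p_{n^2}$ be the first $n^2$ primes. Let $P_n$ be the $n\times n$ prime matrix whose $(i,j)$-entry is $p_{i,j} := p_{(i-1)n+j}$ for $1 \le i,j \le n$. Let $R_i = \prod_{k=1}^n p_{i,k}$ be the product of the entries in row $i$ of $P_n$ and $C_j = \prod_{k=1}^n p_{k,j}$ the product of the entries in column $j$, and let $M = \prod_{i=1}^{n^2} p_i$. Let $x_0$ be the solution, unique modulo $M$, of the system $x + i \equiv 0 \pmod{R_i}$ for $1 \le i \le n$, and let $y_0$ be the solution, unique modulo $M$, of the system $y + j \equiv 0 \pmod{C_j}$ for $1 \le j \le n$. Set $x_i = x_0 + i$, $y_j = y_0 + j$ and $g_{i,j} = \gcd(x_i, y_j)$ for $1 \le i,j \le n$. Let $\mathrm{Gcd}_{P_n}$ be the $n\times n$ matrix whose entry in row $n-(j-1)$ and column $i$ is $g_{i,j}$. Let $\mathrm{AD}_n$ be the $n\times n$ anti-diagonal matrix (ones on the anti-diagonal, zeros elsewhere), and let $\widetilde{\mathrm{Gcd}}_{P_n} = (P_n \cdot \mathrm{AD}_n)^T$, which is the matrix obtained by rotating the entries of $P_n$ by $90^\circ$ counter-clockwise. Then for all $1 \le k,l \le n$, the $(k,l)$-entry of $\widetilde{\mathrm{Gcd}}_{P_n}$ divides the $(k,l)$-entry of $\mathrm{Gcd}_{P_n}$.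
   Context: The systems of congruences have solutions by the Chinese Remainder Theorem, since the row products $R_1,\dots,R_n$ are pairwise coprime, as are the column products $C_1,\dots,C_n$, and $R_1\cdots R_n = C_1 \cdots C_n = M$. The matrix $\mathrm{Gcd}_{P_n}$ (the "gcd-matrix") is the array of values $\gcd(x_i,y_j)$ arranged as the points $(x_i,y_j)$ sit in the plane: column index $i$ corresponds to $x_i$ (left to right) and the row index counts from the bottom, so $g_{1,1}$ is in the bottom-left corner. -}

module Defs where

open import Data.Nat using (ℕ; zero; suc; _+_; _*_; _∸_; _<_)
open import Data.Nat.Primality using (Prime)
open import Data.Nat.GCD using (gcd)
import Data.Fin
open import Data.Fin using (Fin; toℕ; opposite)
open import Data.Product using (∃; _×_)
open import Relation.Binary.PropositionalEquality using (_≡_)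
open import Relation.Nullary.Decidable using (does)
open import Data.Nat using (_≟_)
open import Data.Bool using (if_then_else_)

-- p is the increasing enumeration of ALL primes, 0-indexed:
-- p 0 = 2, p 1 = 3, ... (so the paper's p_k is p (k - 1)).
record PrimeEnum (p : ℕ → ℕ) : Set where
  field
    isPrime    : ∀ k → Prime (p k)
    increasing : ∀ k → p k < p (suc k)
    complete   : ∀ q → Prime q → ∀ k → q < p k → ∃ λ j → j < k × p j ≡ q

-- n × n matrices with natural entries, indexed (row, column) by Fin n (0-based).
Matrix : ℕ → Set
Matrix n = Fin n → Fin n → ℕ

sumF : ∀ {m} → (Fin m → ℕ) → ℕ
sumF {zero}  f = 0
sumF {suc m} f = f Data.Fin.zero + sumF (λ i → f (Data.Fin.suc i))

prodF : ∀ {m} → (Fin m → ℕ) → ℕ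
prodF {zero}  f = 1
prodF {suc m} f = f Data.Fin.zero * prodF (λ i → f (Data.Fin.suc i))

prodℕ : ℕ → (ℕ → ℕ) → ℕ
prodℕ zero    f = 1
prodℕ (suc m) f = prodℕ m f * f m

_·_ : ∀ {n} → Matrix n → Matrix n → Matrix n
(A · B) i j = sumF (λ k → A i k * B k j)

transpose : ∀ {n} → Matrix n → Matrix n
transpose A i j = A j i

AD : ∀ n → Matrix n
AD n i j = if does (toℕ i + toℕ j ≟ n ∸ 1) then 1 else 0

module Construction (n : ℕ) (p : ℕ → ℕ) where
  -- prime matrix, 0-based: P i j = p_{i n + j} (paper: p_{(i-1)n+j}, 1-based)
  P : Matrix n
  P i j = p (toℕ i * n + toℕ j)

  R : Fin n → ℕ
  R i = prodF (λ k → P i k)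

  C : Fin n → ℕ
  C j = prodF (λ k → P k j)

  M : ℕ
  M = prodℕ (n * n) p

  -- x_i = x0 + i, with the paper's 1-based i = toℕ i + 1
  xs : ℕ → Fin n → ℕ
  xs x0 i = x0 + suc (toℕ i)

  ys : ℕ → Fin n → ℕ
  ys y0 j = y0 + suc (toℕ j)

  g : ℕ → ℕ → Fin n → Fin n → ℕ
  g x0 y0 i j = gcd (xs x0 i) (ys y0 j)

  -- entry in row n-(j-1), column i (1-based) is g_{i,j};
  -- 0-based: row r, column c holds g_{c, opposite r}  (bottom row r = n-1 ↔ j = 0)
  GcdP : ℕ → ℕ → Matrix n
  GcdP x0 y0 r c = g x0 y0 c (opposite r)

  GcdP~ : Matrix n
  GcdP~ = transpose (P · AD n)

module Submission where

-- The (k,l)-entry of the rotated prime matrix is the prime P l (opposite k), and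
-- the (k,l)-entry of the gcd-matrix is gcd (x_l) (y_(opposite k)).  Since this
-- prime is an entry of row l of P it divides R l, hence x_l (as R l ∣ x_l); being
-- an entry of column (opposite k) it divides C (opposite k), hence y_(opposite k).
-- So it divides their gcd.

open import Defs
open import Data.Nat using (ℕ; zero; suc; _+_; _*_; _∸_; _<_; _≟_)
open import Data.Nat.Properties using (+-identityʳ; *-identityʳ; *-zeroʳ; m∸n+n≡m; ≤-pred; +-cancelʳ-≡)
open import Data.Nat.Divisibility using (_∣_; ∣-trans; m∣m*n; n∣m*n)
open import Data.Nat.GCD using (gcd-greatest)
open import Data.Fin using (Fin; toℕ; opposite)
import Data.Fin as Fin
open import Data.Fin.Properties using (opposite-prop; toℕ-injective; toℕ<n; suc-injective)
open import Data.Bool using (if_then_else_)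
open import Relation.Nullary using (¬_)
open import Relation.Nullary.Decidable using (dec-true; dec-false)
open import Relation.Binary.PropositionalEquality using (_≡_; _≢_; refl; sym; trans; cong)

sumF-zero : ∀ {m} (f : Fin m → ℕ) → (∀ i → f i ≡ 0) → sumF f ≡ 0
sumF-zero {zero}  f f≡0 = refl
sumF-zero {suc m} f f≡0
  rewrite f≡0 Fin.zero = sumF-zero (λ i → f (Fin.suc i)) (λ i → f≡0 (Fin.suc i))
  where open Data.Nat using (zero)

sumF-single : ∀ {m} (f : Fin m → ℕ) (j : Fin m) →
              (∀ i → i ≢ j → f i ≡ 0) → sumF f ≡ f j
sumF-single f Fin.zero vanish
  rewrite sumF-zero (λ i → f (Fin.suc i)) (λ i → vanish (Fin.suc i) (λ ()))
  = +-identityʳ (f Fin.zero)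
sumF-single f (Fin.suc j) vanish
  rewrite vanish Fin.zero (λ ())
  = sumF-single (λ i → f (Fin.suc i)) j
                (λ i i≢j → vanish (Fin.suc i) (λ eq → i≢j (suc-injective eq)))

factor∣prodF : ∀ {m} (f : Fin m → ℕ) (j : Fin m) → f j ∣ prodF f
factor∣prodF f Fin.zero    = m∣m*n _
factor∣prodF f (Fin.suc j) = ∣-trans (factor∣prodF (λ i → f (Fin.suc i)) j) (n∣m*n (f Fin.zero))

opposite-+ : ∀ {n} (k : Fin n) → toℕ (opposite k) + toℕ k ≡ n ∸ 1
opposite-+ {suc n} k rewrite opposite-prop k = m∸n+n≡m (≤-pred (toℕ<n k))

AD-on : ∀ n (k : Fin n) → AD n (opposite k) k ≡ 1
AD-on n k = cong (λ b → if b then 1 else 0) (dec-true (_ ≟ n ∸ 1) (opposite-+ k))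

AD-off : ∀ n (i k : Fin n) → i ≢ opposite k → AD n i k ≡ 0
AD-off n i k i≢k′ = cong (λ b → if b then 1 else 0) (dec-false (_ ≟ n ∸ 1) on-antidiagonal⇒opposite)
  where
  on-antidiagonal⇒opposite : ¬ (toℕ i + toℕ k ≡ n ∸ 1)
  on-antidiagonal⇒opposite eq =
    i≢k′ (toℕ-injective (+-cancelʳ-≡ (toℕ k) _ _ (trans eq (sym (opposite-+ k)))))

·AD-reverses : ∀ {n} (A : Matrix n) (l k : Fin n) → (A · AD n) l k ≡ A l (opposite k)
·AD-reverses {n} A l k = trans (sumF-single _ (opposite k) off-column) on-column
  where
  off-column : ∀ i → i ≢ opposite k → A l i * AD n i k ≡ 0
  off-column i i≢k′ rewrite AD-off n i k i≢k′ = *-zeroʳ (A l i)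
  on-column : A l (opposite k) * AD n (opposite k) k ≡ A l (opposite k)
  on-column rewrite AD-on n k = *-identityʳ (A l (opposite k))

module _ (n : ℕ) (p : ℕ → ℕ) where
  open Construction n p

  GcdP~-entry : ∀ (k l : Fin n) → GcdP~ k l ≡ P l (opposite k)
  GcdP~-entry k l = ·AD-reverses P l k

  entry∣R : ∀ (i j : Fin n) → P i j ∣ R i
  entry∣R i j = factor∣prodF (P i) j

  entry∣C : ∀ (i j : Fin n) → P i j ∣ C j
  entry∣C i j = factor∣prodF (λ r → P r j) i

proposition3p6 : (n : ℕ) (p : ℕ → ℕ) → PrimeEnum p →
    (x0 y0 : ℕ) →
    x0 < Construction.M n p →
    (∀ (i : Fin n) → Construction.R n p i ∣ x0 + suc (toℕ i)) →
    y0 < Construction.M n p →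
    (∀ (j : Fin n) → Construction.C n p j ∣ y0 + suc (toℕ j)) →
    ∀ (k l : Fin n) → Construction.GcdP~ n p k l ∣ Construction.GcdP n p x0 y0 k l
proposition3p6 n p _ x0 y0 _ R∣x _ C∣y k l
  rewrite GcdP~-entry n p k l =
  gcd-greatest (∣-trans (entry∣R n p l (opposite k)) (R∣x l))
               (∣-trans (entry∣C n p l (opposite k)) (C∣y (opposite k)))
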